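{- Suppose that $I$ is internally related to a basis $B$. Then $\operatorname{supp}_x(F(I)) = \operatorname{supp}_x(F(B))$.
   Context: Let $M$ be a matroid on a finite ground set $E$ with a fixed linear order $<$. For $S\subseteq E$, $\mathrm{EA}(S)$ ($\mathrm{EP}(S)$) is the set of $e\in E\setminus S$ which are (are not) the maximum element of some circuit contained in $S\cup e$; $\mathrm{IA}(S)$ is the set of $i\in S$ that are externally active with respect to $E\setminus S$ in the dual matroid $M^\perp$. Every independent set $I$ is uniquely $I=B\setminus Y$ with $B$ a basis and $Y\subseteq\mathrm{IA}(B)$, and $I$ is then called internally related to $B$. The augmented external activity complex $\Delta_M$ has ground set $\{x_e,y_e,z_e:e\in E\}$ and facets $F(I)=x_{I\cup\mathrm{EP}(I)}\,y_Y\,z_{I\cup\mathrm{EA}(I)}$ for each independent $I=B\setminus Y$, where $x_S=\{x_i:i\in S\}$ etc. and juxtaposition means union. For a face $G$, $\operatorname{supp}_x(G)=\{e\in E: x_e\in G\}$. -}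

module Defs where

open import Data.Nat using (ℕ; _<_)
open import Data.Fin using (Fin; _≤_)
open import Data.Fin.Subset using (Subset; _∈_; _∉_; _⊆_; _⊂_; _∪_; _∩_; ∁; ⁅_⁆; ∣_∣; ⊥)
open import Data.Product using (Σ; ∃; ∃-syntax; _×_)
open import Data.Sum using (_⊎_)
open import Relation.Nullary using (¬_)
open import Relation.Unary using (Decidable)
open import Relation.Binary.PropositionalEquality using (_≡_)

-- Matroid on ground set E = Fin n, linearly ordered by the usual order on Fin n,
-- given by its independent sets.
record Matroid (n : ℕ) : Set₁ where
  field
    Ind       : Subset n → Set
    Ind?      : Decidable Ind
    ind-empty : Ind ⊥
    ind-down  : ∀ {I J} → Ind J → I ⊆ J → Ind I
    ind-aug   : ∀ {I J} → Ind I → Ind J → ∣ I ∣ < ∣ J ∣ →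
                ∃[ e ] (e ∈ J × e ∉ I × Ind (I ∪ ⁅ e ⁆))

module _ {n : ℕ} where

  IsBasisOf : (Subset n → Set) → Subset n → Set
  IsBasisOf P B = P B × (∀ J → P J → B ⊆ J → J ⊆ B)

  IsCircuitOf : (Subset n → Set) → Subset n → Set
  IsCircuitOf P C = ¬ P C × (∀ D → D ⊂ C → P D)

  IsMax : Fin n → Subset n → Set
  IsMax e C = e ∈ C × (∀ f → f ∈ C → f ≤ e)

  ExtActive : (Subset n → Set) → Subset n → Fin n → Set
  ExtActive P S e = e ∉ S × ∃[ C ] (IsCircuitOf P C × C ⊆ (S ∪ ⁅ e ⁆) × IsMax e C)

module _ {n : ℕ} (M : Matroid n) where
  open Matroid M

  IsBasis : Subset n → Set
  IsBasis = IsBasisOf Ind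

  IndDual : Subset n → Set
  IndDual I = ∃[ B ] (IsBasis B × (B ∩ I) ≡ ⊥)

  EA : Subset n → Fin n → Set
  EA S e = ExtActive Ind S e

  EP : Subset n → Fin n → Set
  EP S e = e ∉ S × ¬ ExtActive Ind S e

  -- internally active: i ∈ S externally active w.r.t. E \ S in M^⊥
  IA : Subset n → Fin n → Set
  IA S i = i ∈ S × ExtActive IndDual (∁ S) i

  data Var : Set where
    x y z : Fin n → Var

  -- Facet F(I) for I = B \ Y (the set I and the set Y of the decomposition)
  F : (I Y : Subset n) → Var → Set
  F I Y (x e) = e ∈ I ⊎ EP I e
  F I Y (y e) = e ∈ Y
  F I Y (z e) = e ∈ I ⊎ EA I e

  suppx : (Var → Set) → Fin n → Set
  suppx G e = G (x e)

_≐_ : ∀ {n} → (Fin n → Set) → (Fin n → Set) → Set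
A ≐ B = ∀ e → (A e → B e) × (B e → A e)

-- If e ∉ B is externally active via a circuit C ⊆ B ∪ e with maximum e, then C contains no
-- internally active i ∈ B: otherwise extend C - i to a basis K inside (C - i) ∪ B. Then i ∉ K,
-- and a dual circuit D ⊆ (E ∖ B) ∪ i with maximum i avoids K (an element of K ∩ D would have
-- to be e, forcing e = i ∈ B), so D is independent in the dual. Hence deleting internally
-- active elements from B changes no external activity outside B, while a deleted element e
-- becomes externally passive because (B ∖ Y) ∪ e ⊆ B is independent.
module Submission where

open import Defs hiding (x)
open import Data.Nat using (ℕ; zero; suc; _+_; _≤_; _<_; _<?_)
open import Data.Nat.Properties using (≤-trans; ≤-<-trans; ≤-reflexive; +-suc; +-monoʳ-≤; m≤m+n; ≮⇒≥)
open import Data.Fin using (Fin; _≟_)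
open import Data.Fin.Properties using (≤-antisym)
open import Data.Fin.Subset using (Subset; _∈_; _∉_; _⊆_; _⊂_; _∪_; _∩_; _-_; ∁; ⁅_⁆; ∣_∣; ⊥; Empty)
open import Data.Fin.Subset.Properties
open import Data.Product using (∃-syntax; _×_; _,_; proj₁; proj₂)
open import Data.Sum using (_⊎_; inj₁; inj₂)
open import Data.Empty using (⊥-elim)
open import Function using (_∘_)
open import Relation.Nullary using (¬_; yes; no)
open import Relation.Binary.PropositionalEquality using (_≡_; sym; subst)

private
  variable
    n : ℕ
    p q r : Subset n
    x : Fin n

p⊆r∧q⊆r⇒p∪q⊆r : p ⊆ r → q ⊆ r → p ∪ q ⊆ r
p⊆r∧q⊆r⇒p∪q⊆r p⊆r q⊆r y∈p∪q with x∈p∪q⁻ _ _ y∈p∪q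
... | inj₁ y∈p = p⊆r y∈p
... | inj₂ y∈q = q⊆r y∈q

x∈p⇒⁅x⁆⊆p : x ∈ p → ⁅ x ⁆ ⊆ p
x∈p⇒⁅x⁆⊆p x∈p y∈⁅x⁆ = subst (_∈ _) (sym (x∈⁅y⁆⇒x≡y _ y∈⁅x⁆)) x∈p

x∈p∪q∧x∉q⇒x∈p : x ∈ p ∪ q → x ∉ q → x ∈ p
x∈p∪q∧x∉q⇒x∈p x∈p∪q x∉q with x∈p∪q⁻ _ _ x∈p∪q
... | inj₁ x∈p = x∈p
... | inj₂ x∈q = ⊥-elim (x∉q x∈q)

x∈p∪q∧x∉p⇒x∈q : x ∈ p ∪ q → x ∉ p → x ∈ q
x∈p∪q∧x∉p⇒x∈q x∈p∪q x∉p with x∈p∪q⁻ _ _ x∈p∪q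
... | inj₁ x∈p = ⊥-elim (x∉p x∈p)
... | inj₂ x∈q = x∈q

x∉p⇒p⊂p∪⁅x⁆ : x ∉ p → p ⊂ p ∪ ⁅ x ⁆
x∉p⇒p⊂p∪⁅x⁆ {x = g} x∉p = p⊆p∪q ⁅ g ⁆ , g , q⊆p∪q _ ⁅ g ⁆ (x∈⁅x⁆ g) , x∉p

module _ (M : Matroid n) where
  open Matroid M

  basis-size-maximal : ∀ {B J} → IsBasis M B → Ind J → ¬ ∣ B ∣ < ∣ J ∣
  basis-size-maximal (indB , maxB) indJ B<J with ind-aug indB indJ B<J
  ... | g , _ , g∉B , indB+g = g∉B (maxB _ indB+g (p⊆p∪q ⁅ g ⁆) (q⊆p∪q _ ⁅ g ⁆ (x∈⁅x⁆ g)))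

  large-independent⇒basis : ∀ {B K} → IsBasis M B → Ind K → ∣ B ∣ ≤ ∣ K ∣ → IsBasis M K
  large-independent⇒basis {K = K} basB indK B≤K = indK , maximal
    where
    maximal : ∀ J → Ind J → K ⊆ J → J ⊆ K
    maximal J indJ K⊆J {f} f∈J with f ∈? K
    ... | yes f∈K = f∈K
    ... | no f∉K = ⊥-elim (basis-size-maximal basB
      (ind-down indJ (p⊆r∧q⊆r⇒p∪q⊆r K⊆J (x∈p⇒⁅x⁆⊆p f∈J)))
      (≤-<-trans B≤K (p⊂q⇒∣p∣<∣q∣ (x∉p⇒p⊂p∪⁅x⁆ f∉K))))

  -- Repeated augmentation of J from B, with m as fuel for the number of steps.
  augment : ∀ m {B J} → Ind B → Ind J → ∣ B ∣ ≤ m + ∣ J ∣ →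
            ∃[ K ] (Ind K × J ⊆ K × K ⊆ J ∪ B × ∣ B ∣ ≤ ∣ K ∣)
  augment zero {B} {J} _ indJ B≤J = J , indJ , ⊆-refl , p⊆p∪q B , B≤J
  augment (suc m) {B} {J} indB indJ B≤ with ∣ J ∣ <? ∣ B ∣
  ... | no J≮B = J , indJ , ⊆-refl , p⊆p∪q B , ≮⇒≥ J≮B
  ... | yes J<B with ind-aug indJ indB J<B
  ... | g , g∈B , g∉J , indJ+g with augment m indB indJ+g B≤m+∣J+g∣
    where
    B≤m+∣J+g∣ : ∣ B ∣ ≤ m + ∣ J ∪ ⁅ g ⁆ ∣
    B≤m+∣J+g∣ = ≤-trans B≤ (≤-trans (≤-reflexive (sym (+-suc m ∣ J ∣)))
                                    (+-monoʳ-≤ m (p⊂q⇒∣p∣<∣q∣ (x∉p⇒p⊂p∪⁅x⁆ g∉J))))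
  ... | K , indK , J+g⊆K , K⊆J+g∪B , B≤K =
    K , indK , J+g⊆K ∘ p⊆p∪q ⁅ g ⁆ , J+g∪B⊆J∪B ∘ K⊆J+g∪B , B≤K
    where
    J+g∪B⊆J∪B : (J ∪ ⁅ g ⁆) ∪ B ⊆ J ∪ B
    J+g∪B⊆J∪B = p⊆r∧q⊆r⇒p∪q⊆r
      (p⊆r∧q⊆r⇒p∪q⊆r (p⊆p∪q B) (x∈p⇒⁅x⁆⊆p (q⊆p∪q J B g∈B)))
      (q⊆p∪q J B)

  extend-to-basis : ∀ {B J} → IsBasis M B → Ind J → ∃[ K ] (IsBasis M K × J ⊆ K × K ⊆ J ∪ B)
  extend-to-basis {B} {J} basB indJ with augment ∣ B ∣ (proj₁ basB) indJ (m≤m+n ∣ B ∣ ∣ J ∣)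
  ... | K , indK , J⊆K , K⊆J∪B , B≤K = K , large-independent⇒basis basB indK B≤K , J⊆K , K⊆J∪B

  circuit-minus-independent : ∀ {C i} → IsCircuitOf Ind C → i ∈ C → Ind (C - i)
  circuit-minus-independent circC i∈C = proj₂ circC _ (x∈p⇒p-x⊂p i∈C)

  EA⇒dependent : ∀ {S e} → EA M S e → ¬ Ind (S ∪ ⁅ e ⁆)
  EA⇒dependent (_ , C , (¬indC , _) , C⊆S+e , _) indS+e = ¬indC (ind-down indS+e C⊆S+e)

  EA-mono : ∀ {S T e} → S ⊆ T → e ∉ T → EA M S e → EA M T e
  EA-mono {e = e} S⊆T e∉T (_ , C , circC , C⊆S+e , maxC) =
    e∉T , C , circC , p⊆r∧q⊆r⇒p∪q⊆r (p⊆p∪q ⁅ e ⁆ ∘ S⊆T) (q⊆p∪q _ ⁅ e ⁆) ∘ C⊆S+e , maxC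

  EA-circuit-avoids-IA : ∀ {B C e i} → IsBasis M B → e ∉ B → IsCircuitOf Ind C →
                         C ⊆ B ∪ ⁅ e ⁆ → IsMax e C → i ∈ C → ¬ IA M B i
  EA-circuit-avoids-IA {B} {C} {e} {i} basB e∉B circC C⊆B+e (_ , e-maxC) i∈C
                       (i∈B , _ , D , (¬indD , _) , D⊆∁B+i , (_ , i-maxD))
    with extend-to-basis basB (circuit-minus-independent circC i∈C)
  ... | K , basK , C-i⊆K , K⊆C-i∪B = ¬indD (K , basK , Empty-unique K∩D-empty)
    where
    i∉K : i ∉ K
    i∉K i∈K = proj₁ circC (ind-down (proj₁ basK) C⊆K)
      where
      C⊆K : C ⊆ K
      C⊆K {a} a∈C with a ≟ i
      ... | yes a≡i = subst (_∈ K) (sym a≡i) i∈K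
      ... | no a≢i = C-i⊆K (x∈p∧x≢y⇒x∈p-y a∈C a≢i)

    K∩D-empty : Empty (K ∩ D)
    K∩D-empty (a , a∈K∩D) = e∉B (subst (_∈ B) (sym e≡i) i∈B)
      where
      a∈K : a ∈ K
      a∈K = proj₁ (x∈p∩q⁻ K D a∈K∩D)
      a∈D : a ∈ D
      a∈D = proj₂ (x∈p∩q⁻ K D a∈K∩D)
      a∉B : a ∉ B
      a∉B = x∈∁p⇒x∉p (x∈p∪q∧x∉q⇒x∈p (D⊆∁B+i a∈D)
                        (x≢y⇒x∉⁅y⁆ (λ a≡i → i∉K (subst (_∈ K) a≡i a∈K))))
      a≡e : a ≡ e
      a≡e = x∈⁅y⁆⇒x≡y e (x∈p∪q∧x∉p⇒x∈q
              (C⊆B+e (p─q⊆p C ⁅ i ⁆ (x∈p∪q∧x∉q⇒x∈p (K⊆C-i∪B a∈K) a∉B))) a∉B)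
      e≡i : e ≡ i
      e≡i = ≤-antisym (i-maxD e (subst (_∈ D) a≡e a∈D)) (e-maxC i i∈C)

  EA-remove-IA : ∀ {B Y e} → IsBasis M B → (∀ i → i ∈ Y → IA M B i) →
                 EA M B e → EA M (B ∩ ∁ Y) e
  EA-remove-IA {B} {Y} {e} basB Y⊆IA (e∉B , C , circC , C⊆B+e , maxC) =
    e∉B ∘ p∩q⊆p B (∁ Y) , C , circC , C⊆I+e , maxC
    where
    C⊆I+e : C ⊆ (B ∩ ∁ Y) ∪ ⁅ e ⁆
    C⊆I+e {a} a∈C with x∈p∪q⁻ B ⁅ e ⁆ (C⊆B+e a∈C) | a ∈? Y
    ... | inj₂ a∈⁅e⁆ | _     = q⊆p∪q _ ⁅ e ⁆ a∈⁅e⁆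
    ... | inj₁ a∈B   | no a∉Y = p⊆p∪q ⁅ e ⁆ (x∈p∩q⁺ (a∈B , x∉p⇒x∈∁p a∉Y))
    ... | inj₁ _     | yes a∈Y =
      ⊥-elim (EA-circuit-avoids-IA basB e∉B circC C⊆B+e maxC a∈C (Y⊆IA a a∈Y))

proposition5p3 : ∀ {n : ℕ} (M : Matroid n) (B Y : Subset n) →
    IsBasis M B → (∀ i → i ∈ Y → IA M B i) →
    suppx M (F M (B ∩ ∁ Y) Y) ≐ suppx M (F M B ⊥)
proposition5p3 M B Y basB Y⊆IA e = to , from
  where
  open Matroid M
  I : Subset _
  I = B ∩ ∁ Y
  I⊆B : I ⊆ B
  I⊆B = p∩q⊆p B (∁ Y)

  to : e ∈ I ⊎ EP M I e → e ∈ B ⊎ EP M B e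
  to (inj₁ e∈I) = inj₁ (I⊆B e∈I)
  to (inj₂ (_ , ¬EA-I)) with e ∈? B
  ... | yes e∈B = inj₁ e∈B
  ... | no e∉B = inj₂ (e∉B , ¬EA-I ∘ EA-remove-IA M basB Y⊆IA)

  from : e ∈ B ⊎ EP M B e → e ∈ I ⊎ EP M I e
  from (inj₁ e∈B) with e ∈? Y
  ... | no e∉Y = inj₁ (x∈p∩q⁺ (e∈B , x∉p⇒x∈∁p e∉Y))
  ... | yes e∈Y = inj₂ (x∈p⇒x∉∁p e∈Y ∘ p∩q⊆q B (∁ Y) ,
      λ EA-I → EA⇒dependent M EA-I (ind-down (proj₁ basB) (p⊆r∧q⊆r⇒p∪q⊆r I⊆B (x∈p⇒⁅x⁆⊆p e∈B))))
  from (inj₂ (e∉B , ¬EA-B)) = inj₂ (e∉B ∘ I⊆B , ¬EA-B ∘ EA-mono M I⊆B e∉B)
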